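{- Let $G=(V,E)$ be a connected VC-irreducible graph and let $e=\{u,v\}\in E$ be an edge such that $u$ and $v$ are neighbor-equivalent. Then $H=G\setminus u$ is VC-irreducible, and the minimum vertex cover size of $H$ is one less than the minimum vertex cover size of $G$.
   Context: A vertex cover is a set of vertices meeting every edge. A connected graph $G=(V,E)$ is VC-irreducible if for every edge $e\in E$ the graph $(V,E\setminus\{e\})$ has strictly smaller minimum vertex cover size than $G$. Two adjacent vertices $u,v$ are neighbor-equivalent if $N_G(v)\setminus\{u\}=N_G(u)\setminus\{v\}$, where $N_G$ denotes neighborhood. $G\setminus u$ is the graph obtained by deleting $u$ and its incident edges. -}

module Defs where

open import Data.Nat using (ℕ; suc; _≤_; _<_)
open import Data.Fin using (Fin; punchIn)
open import Data.Fin.Subset using (Subset; _∈_; ∣_∣)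
open import Data.Product using (_×_; Σ-syntax; ∃-syntax)
open import Data.Sum using (_⊎_)
open import Relation.Nullary using (¬_)
open import Relation.Binary.PropositionalEquality using (_≡_; _≢_)
open import Function.Bundles using (_⇔_)

Graph : ℕ → Set₁
Graph n = Fin n → Fin n → Set

IsSimple : ∀ {n} → Graph n → Set
IsSimple {n} G = (∀ (i j : Fin n) → G i j → G j i) × (∀ (i : Fin n) → ¬ G i i)

data Reach {n} (G : Graph n) : Fin n → Fin n → Set where
  here : ∀ {i} → Reach G i i
  step : ∀ {i j k} → G i j → Reach G j k → Reach G i k

Connected : ∀ {n} → Graph n → Set
Connected {n} G = ∀ (i j : Fin n) → Reach G i j

IsVertexCover : ∀ {n} → Graph n → Subset n → Set
IsVertexCover {n} G C = ∀ (i j : Fin n) → G i j → i ∈ C ⊎ j ∈ C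

MinVC : ∀ {n} → Graph n → ℕ → Set
MinVC {n} G k =
  (∃[ C ] (IsVertexCover G C × ∣ C ∣ ≡ k)) ×
  (∀ (C : Subset n) → IsVertexCover G C → k ≤ ∣ C ∣)

deleteEdge : ∀ {n} → Graph n → Fin n → Fin n → Graph n
deleteEdge G u v i j = G i j × ¬ ((i ≡ u × j ≡ v) ⊎ (i ≡ v × j ≡ u))

deleteVertex : ∀ {n} → Graph (suc n) → Fin (suc n) → Graph n
deleteVertex G u i j = G (punchIn u i) (punchIn u j)

VCIrreducible : ∀ {n} → Graph n → Set
VCIrreducible {n} G =
  Connected G ×
  (∀ (u v : Fin n) → G u v → ∀ (k k' : ℕ) →
     MinVC G k → MinVC (deleteEdge G u v) k' → k' < k)

NeighborEquivalent : ∀ {n} → Graph n → Fin n → Fin n → Set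
NeighborEquivalent {n} G u v =
  G u v × (∀ (w : Fin n) → ((G v w × w ≢ u) ⇔ (G u w × w ≢ v)))

-- Write τ for the minimum vertex cover size and v = punchIn u p for the partner of u. A cover of
-- G ∖ u plus u covers G. Conversely a cover D of G either contains u, and D ∖ {u} covers G ∖ u,
-- or it contains every neighbour of u, and then already D ∖ {u, v} covers G ∖ u, because
-- N(v) ∖ {u} ⊆ N(u). Hence τ(G) = τ(G ∖ u) + 1. This argument survives deleting an edge of G ∖ u
-- from both graphs, so the drop of τ on deleting that edge from G transfers to G ∖ u. Finally,
-- contracting u onto v maps walks of G to walks of G ∖ u, because N(u) ∖ {v} ⊆ N(v).
module Submission where

open import Defs
open import Data.Nat using (ℕ; suc; _≤_; s≤s; s≤s⁻¹)
open import Data.Nat.Properties using (≤-antisym; ≤-refl; m≤n⇒m≤1+n; module ≤-Reasoning)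
open import Data.Fin using (Fin; zero; suc; punchIn; punchOut; _≟_)
open import Data.Fin.Properties using (punchIn-injective; punchInᵢ≢i; punchIn-punchOut; punchOut-punchIn; punchOut-cong)
open import Data.Fin.Subset using (Subset; inside; outside; _∈_; _∉_; _-_; ∣_∣)
open import Data.Fin.Subset.Properties using (_∈?_; x∈p∧x≢y⇒x∈p-y; x∈p⇒∣p-x∣<∣p∣)
open import Data.Vec using (Vec; _∷_; lookup; insertAt; removeAt)
open import Data.Vec.Properties using (insertAt-lookup; insertAt-punchIn; insertAt-removeAt; []=⇒lookup; lookup⇒[]=)
open import Data.Product as Product using (_×_; _,_; proj₁; ∃-syntax)
open import Data.Sum as Sum using (_⊎_; inj₁; inj₂; [_,_]′)
open import Relation.Nullary using (yes; no; contradiction)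
open import Relation.Binary.PropositionalEquality using (_≡_; _≢_; refl; sym; trans; cong; subst; subst₂; module ≡-Reasoning)
open import Function.Base using (_∘_)
open import Function.Bundles using (_⇔_; mk⇔; Equivalence)

private
  variable
    n k : ℕ

∣insertAt-inside∣≡1+∣p∣ : ∀ (p : Subset n) i → ∣ insertAt p i inside ∣ ≡ suc ∣ p ∣
∣insertAt-inside∣≡1+∣p∣ p             zero    = refl
∣insertAt-inside∣≡1+∣p∣ (inside ∷ p)  (suc i) = cong suc (∣insertAt-inside∣≡1+∣p∣ p i)
∣insertAt-inside∣≡1+∣p∣ (outside ∷ p) (suc i) = ∣insertAt-inside∣≡1+∣p∣ p i

∣p∣≤∣insertAt∣ : ∀ (p : Subset n) i x → ∣ p ∣ ≤ ∣ insertAt p i x ∣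
∣p∣≤∣insertAt∣ p             zero    inside  = m≤n⇒m≤1+n ≤-refl
∣p∣≤∣insertAt∣ p             zero    outside = ≤-refl
∣p∣≤∣insertAt∣ (inside ∷ p)  (suc i) x       = s≤s (∣p∣≤∣insertAt∣ p i x)
∣p∣≤∣insertAt∣ (outside ∷ p) (suc i) x       = ∣p∣≤∣insertAt∣ p i x

x∈p⇒∣p∣≡1+∣removeAt∣ : ∀ {p : Subset (suc n)} {x} → x ∈ p → ∣ p ∣ ≡ suc ∣ removeAt p x ∣
x∈p⇒∣p∣≡1+∣removeAt∣ {p = p} {x} x∈p = begin
  ∣ p ∣                                       ≡⟨ cong ∣_∣ (insertAt-removeAt p x) ⟨
  ∣ insertAt (removeAt p x) x (lookup p x) ∣  ≡⟨ cong (λ b → ∣ insertAt (removeAt p x) x b ∣) ([]=⇒lookup x∈p) ⟩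
  ∣ insertAt (removeAt p x) x inside ∣        ≡⟨ ∣insertAt-inside∣≡1+∣p∣ (removeAt p x) x ⟩
  suc ∣ removeAt p x ∣                        ∎
  where open ≡-Reasoning

∣removeAt∣≤∣p∣ : ∀ (p : Subset (suc n)) x → ∣ removeAt p x ∣ ≤ ∣ p ∣
∣removeAt∣≤∣p∣ p x = subst (∣ removeAt p x ∣ ≤_) (cong ∣_∣ (insertAt-removeAt p x))
                       (∣p∣≤∣insertAt∣ (removeAt p x) x (lookup p x))

lookup-removeAt : ∀ {a} {A : Set a} (xs : Vec A (suc n)) i j →
                  lookup (removeAt xs i) j ≡ lookup xs (punchIn i j)
lookup-removeAt xs i j = begin
  lookup (removeAt xs i) j                                      ≡⟨ insertAt-punchIn (removeAt xs i) i (lookup xs i) j ⟨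
  lookup (insertAt (removeAt xs i) i (lookup xs i)) (punchIn i j) ≡⟨ cong (λ ys → lookup ys (punchIn i j)) (insertAt-removeAt xs i) ⟩
  lookup xs (punchIn i j)                                       ∎
  where open ≡-Reasoning

x∈insertAt[x]inside : ∀ (p : Subset n) x → x ∈ insertAt p x inside
x∈insertAt[x]inside p x = lookup⇒[]= x _ (insertAt-lookup p x inside)

y∈p⇒punchIn[y]∈insertAt : ∀ {p : Subset n} {y} x b → y ∈ p → punchIn x y ∈ insertAt p x b
y∈p⇒punchIn[y]∈insertAt {p = p} {y} x b y∈p =
  lookup⇒[]= (punchIn x y) _ (trans (insertAt-punchIn p x b y) ([]=⇒lookup y∈p))

punchIn[y]∈p⇒y∈removeAt : ∀ {p : Subset (suc n)} x {y} → punchIn x y ∈ p → y ∈ removeAt p x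
punchIn[y]∈p⇒y∈removeAt {p = p} x {y} ∈p =
  lookup⇒[]= y _ (trans (lookup-removeAt p x y) ([]=⇒lookup ∈p))

data PunchView (u : Fin (suc n)) : Fin (suc n) → Set where
  pivot   : PunchView u u
  punched : ∀ i → PunchView u (punchIn u i)

punchView : ∀ (u x : Fin (suc n)) → PunchView u x
punchView u x with u ≟ x
... | yes refl = pivot
... | no u≢x   = subst (PunchView u) (punchIn-punchOut u≢x) (punched (punchOut u≢x))

contract : Fin (suc n) → Fin n → Fin (suc n) → Fin n
contract u p x with u ≟ x
... | yes _  = p
... | no u≢x = punchOut u≢x

contract-pivot : ∀ (u : Fin (suc n)) p → contract u p u ≡ p
contract-pivot u p with u ≟ u
... | yes _ = refl
... | no u≢u = contradiction refl u≢u

contract-punchIn : ∀ (u : Fin (suc n)) p i → contract u p (punchIn u i) ≡ i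
contract-punchIn u p i with u ≟ punchIn u i
... | yes u≡i↑ = contradiction (sym u≡i↑) (punchInᵢ≢i u i)
... | no u≢i↑  = trans (punchOut-cong u refl) (punchOut-punchIn u)

Reach-map : ∀ {m} {G : Graph m} {H : Graph n} (f : Fin m → Fin n) →
            (∀ {x y} → G x y → f x ≡ f y ⊎ H (f x) (f y)) →
            ∀ {x y} → Reach G x y → Reach H (f x) (f y)
Reach-map f edge here = here
Reach-map {H = H} f edge (step {k = z} xy r) with edge xy
... | inj₁ fx≡fy = subst (λ w → Reach H w (f z)) (sym fx≡fy) (Reach-map f edge r)
... | inj₂ fxfy  = step fxfy (Reach-map f edge r)

Dominates : Graph n → Fin n → Fin n → Set
Dominates {n} G x y = ∀ (z : Fin n) → G y z → z ≢ x → G x z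

MinVC-unique : ∀ (G : Graph n) {a b} → MinVC G a → MinVC G b → a ≡ b
MinVC-unique G ((C , C-cov , refl) , a-min) ((D , D-cov , refl) , b-min) =
  ≤-antisym (a-min D D-cov) (b-min C C-cov)

MinVC-resp-⇔ : ∀ {G H : Graph n} → (∀ i j → G i j ⇔ H i j) → MinVC G k → MinVC H k
MinVC-resp-⇔ G⇔H ((C , cov , size) , min) =
  (C , (λ i j ij → cov i j (Equivalence.from (G⇔H i j) ij)) , size) ,
  (λ D D-cov → min D (λ i j ij → D-cov i j (Equivalence.to (G⇔H i j) ij)))

connected-deleteVertex : ∀ {G : Graph (suc n)} {u p} → IsSimple G → G u (punchIn u p) →
                         Dominates G (punchIn u p) u → Connected G → Connected (deleteVertex G u)
connected-deleteVertex {G = G} {u} {p} (symmetric , _) up p⊒u connected i j =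
  subst₂ (Reach H) (contract-punchIn u p i) (contract-punchIn u p j)
    (Reach-map (contract u p) edge (connected (punchIn u i) (punchIn u j)))
  where
  H = deleteVertex G u

  fromPivot : ∀ j → G u (punchIn u j) → p ≡ j ⊎ H p j
  fromPivot j uj with p ≟ j
  ... | yes p≡j = inj₁ p≡j
  ... | no p≢j  = inj₂ (p⊒u (punchIn u j) uj (p≢j ∘ sym ∘ punchIn-injective u j p))

  edge : ∀ {x y} → G x y → contract u p x ≡ contract u p y ⊎ H (contract u p x) (contract u p y)
  edge {x} {y} xy with punchView u x | punchView u y
  ... | pivot     | pivot     = inj₁ refl
  ... | pivot     | punched j rewrite contract-pivot u p | contract-punchIn u p j =
    fromPivot j xy
  ... | punched i | pivot     rewrite contract-pivot u p | contract-punchIn u p i =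
    Sum.map sym (symmetric _ _) (fromPivot i (symmetric _ _ xy))
  ... | punched i | punched j rewrite contract-punchIn u p i | contract-punchIn u p j =
    inj₂ xy

insertAt-isVertexCover : ∀ {G : Graph (suc n)} {u C} →
                         IsVertexCover (deleteVertex G u) C → IsVertexCover G (insertAt C u inside)
insertAt-isVertexCover {u = u} {C} cover x y xy with punchView u x | punchView u y
... | pivot     | _         = inj₁ (x∈insertAt[x]inside C u)
... | punched i | pivot     = inj₂ (x∈insertAt[x]inside C u)
... | punched i | punched j =
  Sum.map (y∈p⇒punchIn[y]∈insertAt u inside) (y∈p⇒punchIn[y]∈insertAt u inside) (cover i j xy)

removeAt-isVertexCover : ∀ {G : Graph (suc n)} {u D} →
                         IsVertexCover G D → IsVertexCover (deleteVertex G u) (removeAt D u)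
removeAt-isVertexCover {u = u} cover i j ij =
  Sum.map (punchIn[y]∈p⇒y∈removeAt u) (punchIn[y]∈p⇒y∈removeAt u) (cover _ _ ij)

u∉cover⇒N[u]⊆cover : ∀ {G : Graph n} {D u x} → IsVertexCover G D → u ∉ D → G u x → x ∈ D
u∉cover⇒N[u]⊆cover cover u∉D ux = [ (λ u∈D → contradiction u∈D u∉D) , (λ x∈D → x∈D) ]′ (cover _ _ ux)

-- A cover avoiding u contains N(u) ∋ punchIn u p, hence N(punchIn u p) ∖ {u}, so p is redundant.
removeAt-minus-isVertexCover : ∀ {G : Graph (suc n)} {u p D} → IsSimple G →
                               Dominates G u (punchIn u p) → IsVertexCover G D → u ∉ D →
                               IsVertexCover (deleteVertex G u) (removeAt D u - p)
removeAt-minus-isVertexCover {G = G} {u} {p} {D} (symmetric , loopless) u⊒p cover u∉D = cover′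
  where
  neighbour∈D : ∀ {x} → G u x → x ∈ D
  neighbour∈D = u∉cover⇒N[u]⊆cover cover u∉D

  keep : ∀ {j} → j ≢ p → punchIn u j ∈ D → j ∈ removeAt D u - p
  keep j≢p j↑∈D = x∈p∧x≢y⇒x∈p-y (punchIn[y]∈p⇒y∈removeAt u j↑∈D) j≢p

  cover′ : IsVertexCover (deleteVertex G u) (removeAt D u - p)
  cover′ i j ij with i ≟ p | j ≟ p
  ... | yes refl | yes refl = contradiction ij (loopless _)
  ... | yes refl | no j≢p   = inj₂ (keep j≢p (neighbour∈D (u⊒p _ ij (punchInᵢ≢i u j))))
  ... | no i≢p   | yes refl = inj₁ (keep i≢p (neighbour∈D (u⊒p _ (symmetric _ _ ij) (punchInᵢ≢i u i))))
  ... | no i≢p   | no j≢p   = Sum.map (keep i≢p) (keep j≢p) (cover _ _ ij)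

minVC-deleteVertex : ∀ {G : Graph (suc n)} {u p} → IsSimple G → G u (punchIn u p) →
                     Dominates G u (punchIn u p) → MinVC (deleteVertex G u) k → MinVC G (suc k)
minVC-deleteVertex {G = G} {u} {p} simple up u⊒p ((C , cover , refl) , minimal) =
  (insertAt C u inside , insertAt-isVertexCover cover , ∣insertAt-inside∣≡1+∣p∣ C u) , lowerBound
  where
  lowerBound : ∀ D → IsVertexCover G D → suc ∣ C ∣ ≤ ∣ D ∣
  lowerBound D D-cover with u ∈? D
  ... | yes u∈D = begin
    suc ∣ C ∣              ≤⟨ s≤s (minimal _ (removeAt-isVertexCover D-cover)) ⟩
    suc ∣ removeAt D u ∣   ≡⟨ x∈p⇒∣p∣≡1+∣removeAt∣ u∈D ⟨
    ∣ D ∣                  ∎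
    where open ≤-Reasoning
  ... | no u∉D = begin-strict
    ∣ C ∣                  ≤⟨ minimal _ (removeAt-minus-isVertexCover simple u⊒p D-cover u∉D) ⟩
    ∣ removeAt D u - p ∣   <⟨ x∈p⇒∣p-x∣<∣p∣ p∈removeAt ⟩
    ∣ removeAt D u ∣       ≤⟨ ∣removeAt∣≤∣p∣ D u ⟩
    ∣ D ∣                  ∎
    where
    open ≤-Reasoning
    p∈removeAt : p ∈ removeAt D u
    p∈removeAt = punchIn[y]∈p⇒y∈removeAt u (u∉cover⇒N[u]⊆cover D-cover u∉D up)

deleteEdge-simple : ∀ {G : Graph n} {a b} → IsSimple G → IsSimple (deleteEdge G a b)
deleteEdge-simple (symmetric , loopless) =
  (λ i j (ij , ¬ab) → symmetric i j ij , ¬ab ∘ Sum.swap ∘ Sum.map Product.swap Product.swap) ,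
  (λ i (ii , _) → loopless i ii)

deleteEdge-keeps : ∀ {G : Graph n} {a b x y} → x ≢ a → x ≢ b → G x y → deleteEdge G a b x y
deleteEdge-keeps x≢a x≢b xy = xy , [ x≢a ∘ proj₁ , x≢b ∘ proj₁ ]′

deleteEdge-dominates : ∀ {G : Graph n} {a b x y} → x ≢ a → x ≢ b →
                       Dominates G x y → Dominates (deleteEdge G a b) x y
deleteEdge-dominates {G = G} x≢a x≢b x⊒y z (yz , _) z≢x =
  deleteEdge-keeps {G = G} x≢a x≢b (x⊒y z yz z≢x)

deleteEdge-deleteVertex : ∀ (G : Graph (suc n)) u a b i j →
                          deleteEdge (deleteVertex G u) a b i j ⇔
                          deleteVertex (deleteEdge G (punchIn u a) (punchIn u b)) u i j
deleteEdge-deleteVertex G u a b i j = mk⇔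
  (Product.map₂ (λ ¬ab → ¬ab ∘ Sum.map (Product.map injective injective) (Product.map injective injective)))
  (Product.map₂ (λ ¬ab → ¬ab ∘ Sum.map (Product.map (cong ↑) (cong ↑)) (Product.map (cong ↑) (cong ↑))))
  where
  ↑ = punchIn u
  injective : ∀ {x y} → ↑ x ≡ ↑ y → x ≡ y
  injective = punchIn-injective u _ _

vcIrreducible-deleteVertex : ∀ {G : Graph (suc n)} {u p} → IsSimple G → G u (punchIn u p) →
                             Dominates G u (punchIn u p) → Dominates G (punchIn u p) u →
                             VCIrreducible G → VCIrreducible (deleteVertex G u)
vcIrreducible-deleteVertex {G = G} {u} {p} simple up u⊒p p⊒u (connected , irreducible) =
  connected-deleteVertex simple up p⊒u connected ,
  λ a b ab k k′ τ[H] τ[H-ab] →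
    let u≢a = punchInᵢ≢i u a ∘ sym
        u≢b = punchInᵢ≢i u b ∘ sym
    in s≤s⁻¹ (irreducible (punchIn u a) (punchIn u b) ab (suc k) (suc k′)
                (minVC-deleteVertex {p = p} simple up u⊒p τ[H])
                (minVC-deleteVertex {p = p} (deleteEdge-simple simple) (deleteEdge-keeps {G = G} u≢a u≢b up)
                   (deleteEdge-dominates {G = G} u≢a u≢b u⊒p)
                   (MinVC-resp-⇔ (deleteEdge-deleteVertex G u a b) τ[H-ab])))

neighborEquivalent⇒mutuallyDominating :
  ∀ {G : Graph (suc n)} {u v} → IsSimple G → NeighborEquivalent G u v →
  ∃[ p ] (G u (punchIn u p) × Dominates G u (punchIn u p) × Dominates G (punchIn u p) u)
neighborEquivalent⇒mutuallyDominating {u = u} {v} (_ , loopless) (uv , equivalent) with punchView u v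
... | pivot     = contradiction uv (loopless u)
... | punched p =
  p , uv ,
  (λ z pz z≢u → proj₁ (Equivalence.to (equivalent z) (pz , z≢u))) ,
  (λ z uz z≢p → proj₁ (Equivalence.from (equivalent z) (uz , z≢p)))

theorem10 : ∀ {n : ℕ} (G : Graph (suc n)) → IsSimple G → VCIrreducible G →
    ∀ (u v : Fin (suc n)) → NeighborEquivalent G u v →
    VCIrreducible (deleteVertex G u) ×
    (∀ (k k' : ℕ) → MinVC G k → MinVC (deleteVertex G u) k' → k ≡ suc k')
theorem10 G simple irreducible u v equivalent
  with neighborEquivalent⇒mutuallyDominating simple equivalent
... | p , up , u⊒p , p⊒u =
  vcIrreducible-deleteVertex simple up u⊒p p⊒u irreducible ,
  λ k k′ τ[G] τ[H] → MinVC-unique G τ[G] (minVC-deleteVertex {p = p} simple up u⊒p τ[H])
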